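{- Let $T_1$ and $T_2$ be trees of orders $m$ and $n$ with $|W(T_1)|=|W(T_2)|=2$, and let $p=mn$. For any ordering $(z_0,z_1,\ldots,z_{p-1})$ of $V(T_1\Box T_2)$, $$\sum_{i=0}^{p-2}\delta(z_i,z_{i+1})\le 2p-3.$$ Moreover, equality holds if and only if $\delta(z_{p/2-1},z_{p/2})=1$ and $\delta(z_t,z_{t+1})=2$ for all other $t\in\{0,\ldots,p-2\}$.
   Context: For a tree $T$ and $v\in V(T)$, $w_T(v)=\sum_{u\in V(T)}d(u,v)$; a weight center is a vertex minimizing $w_T$ and $W(T)$ is the set of weight centers. If $W(T)=\{w,w'\}$ then $w,w'$ are adjacent and the two components of $T-ww'$ have equal size. For a tree $T$, $\delta_T(u,v)=1$ if $W(T)=\{w,w'\}$ has two elements and $u,v$ lie in different components of $T-ww'$; otherwise $\delta_T(u,v)=0$. For vertices $z_a=(x_a,y_a)$, $z_b=(x_b,y_b)$ of the Cartesian product $T_1\Box T_2$, $\delta(z_a,z_b)=\delta_{T_1}(x_a,x_b)+\delta_{T_2}(y_a,y_b)$. -}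

module Defs where

open import Data.Nat using (ℕ; zero; suc; _+_; _*_; _∸_; _≤_; _≤ᵇ_)
open import Data.Bool using (Bool; true; false; _∧_; _∨_; not; if_then_else_; T)
open import Data.Fin using (Fin; zero; suc; inject₁; fromℕ)
open import Data.Fin.Properties using (_≟_)
open import Data.List using (List; []; _∷_; allFin; map; filterᵇ)
open import Data.Bool.ListAction using (any; all)
open import Data.Nat.ListAction using (sum)
open import Data.Product using (Σ; _×_; _,_; ∃; proj₁; proj₂)
open import Data.Sum using (_⊎_)
open import Relation.Nullary using (¬_; does)
open import Relation.Binary.PropositionalEquality using (_≡_; _≢_)
open import Function.Definitions using (Injective)

record Graph (m : ℕ) : Set where
  field
    adj    : Fin m → Fin m → Bool
    adjSym : ∀ u v → adj u v ≡ adj v u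
    adjIrr : ∀ u → adj u u ≡ false
open Graph public

data Walk {m : ℕ} (G : Graph m) : Fin m → Fin m → ℕ → Set where
  here : ∀ {u} → Walk G u u 0
  step : ∀ {u x v k} → T (adj G u x) → Walk G x v k → Walk G u v (suc k)

Connected : ∀ {m} → Graph m → Set
Connected {m} G = ∀ (u v : Fin m) → ∃ λ k → Walk G u v k

-- a cycle: k+3 pairwise distinct vertices c_0,...,c_{k+2}, consecutive
-- ones adjacent and c_{k+2} adjacent to c_0
HasCycle : ∀ {m} → Graph m → Set
HasCycle {m} G =
  Σ ℕ λ k → Σ (Fin (suc (suc (suc k))) → Fin m) λ c →
    Injective _≡_ _≡_ c ×
    (∀ (i : Fin (suc (suc k))) → T (adj G (c (inject₁ i)) (c (suc i)))) ×
    T (adj G (c (fromℕ (suc (suc k)))) (c zero))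

record Tree (m : ℕ) : Set where
  field
    graph     : Graph m
    connected : Connected graph
    acyclic   : ¬ HasCycle graph
open Tree public

eqB : ∀ {m} → Fin m → Fin m → Bool
eqB u v = does (u ≟ v)

reach : ∀ {m} → (Fin m → Fin m → Bool) → ℕ → Fin m → Fin m → Bool
reach {m} A zero    u v = eqB u v
reach {m} A (suc k) u v =
  reach A k u v ∨ any (λ x → A u x ∧ reach A k x v) (allFin m)

minSearch : (ℕ → Bool) → ℕ → ℕ → ℕ
minSearch f zero       start = start
minSearch f (suc fuel) start =
  if f start then start else minSearch f fuel (suc start)

dist : ∀ {m} → Tree m → Fin m → Fin m → ℕ
dist {m} T u v = minSearch (λ k → reach (adj (graph T)) k u v) m 0

weight : ∀ {m} → Tree m → Fin m → ℕ
weight {m} T v = sum (map (λ u → dist T u v) (allFin m))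

IsWeightCenter : ∀ {m} → Tree m → Fin m → Set
IsWeightCenter {m} T v = ∀ (u : Fin m) → weight T v ≤ weight T u

TwoWeightCenters : ∀ {m} → Tree m → Set
TwoWeightCenters {m} T =
  Σ (Fin m) λ w → Σ (Fin m) λ w' →
    w ≢ w' × IsWeightCenter T w × IsWeightCenter T w' ×
    (∀ v → IsWeightCenter T v → v ≡ w ⊎ v ≡ w')

isWeightCenterB : ∀ {m} → Tree m → Fin m → Bool
isWeightCenterB {m} T v = all (λ u → weight T v ≤ᵇ weight T u) (allFin m)

weightCenters : ∀ {m} → Tree m → List (Fin m)
weightCenters {m} T = filterᵇ (λ v → isWeightCenterB T v) (allFin m)

removeEdge : ∀ {m} → (Fin m → Fin m → Bool) → Fin m → Fin m →
             Fin m → Fin m → Bool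
removeEdge A w w' a b =
  A a b ∧ not ((eqB a w ∧ eqB b w') ∨ (eqB a w' ∧ eqB b w))

δT : ∀ {m} → Tree m → Fin m → Fin m → ℕ
δT {m} T u v with weightCenters T
... | w ∷ w' ∷ [] =
        if reach (removeEdge (adj (graph T)) w w') m u v then 0 else 1
... | _ = 0

δ : ∀ {m n} → Tree m → Tree n → Fin m × Fin n → Fin m × Fin n → ℕ
δ T₁ T₂ (xa , ya) (xb , yb) = δT T₁ xa xb + δT T₂ ya yb

consecutiveSum : ∀ {m n q} → Tree m → Tree n →
                 (Fin (suc q) → Fin m × Fin n) → ℕ
consecutiveSum {q = q} T₁ T₂ z =
  sum (map (λ (i : Fin q) → δ T₁ T₂ (z (inject₁ i)) (z (suc i))) (allFin q))

-- Removing the edge cc' between the two weight centers of a tree splits it into two sides, and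
-- δT u v = 1 exactly when u and v lie on different sides. Passing from c to c' moves every vertex
-- one step closer or farther according to its side, so weight c ≡ weight c' forces the two sides to
-- have equal size. Colour a vertex (x , y) of the product by the parity of its two side bits: each
-- colour class has p/2 vertices, every term δ(z_t, z_{t+1}) is at most 2, and it is 1 exactly when
-- the colour changes from z_t to z_{t+1}. Both colours occur, so some term is at most 1, which gives
-- the bound 2(p-1) - 1. Equality forces a single colour change, at t*; then z_0, …, z_{t*} is a
-- whole colour class, so t* + 1 = p/2.

module Submission where

open import Defs
open import Data.Nat using (ℕ; zero; suc; _+_; _*_; _∸_; _/_; _≤_; _<_; z≤n; s≤s; s≤s⁻¹; pred; _≤?_)
open import Data.Nat.Properties
  using ( +-comm; +-assoc; +-suc; +-identityʳ; *-identityʳ; *-assoc; *-comm; +-mono-≤; *-mono-≤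
        ; ≤-refl; ≤-reflexive; ≤-trans; ≤-antisym; n≤1+n; m≤n⇒m≤1+n; <⇒≤; <⇒≢; <⇒≱; ≰⇒>; ≤∧≢⇒<
        ; <⇒≤pred; pred-mono-≤; suc-injective; +-cancelˡ-≡; ≤ᵇ⇒≤; ≤⇒≤ᵇ; +-0-commutativeMonoid )
open import Data.Nat.DivMod using (m*n/n≡m; m/n<m)
open import Data.Nat.ListAction using (sum)
open import Data.Bool using (Bool; true; false; _∧_; _∨_; _xor_; not; T; if_then_else_)
open import Data.Bool.Properties
  using ( T-∨; T-∧; T-≡; T-not-≡; T?; ∨-comm; ∧-comm; ¬-not; not-injective
        ; xor-assoc; xor-same; xor-inverseˡ; not-distribˡ-xor; not-distribʳ-xor; xor-annihilates-not )
import Data.Bool.Properties as Bool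
open import Data.Fin using (Fin; zero; suc; toℕ; inject₁; fromℕ; _↑ˡ_; _↑ʳ_; combine; remQuot)
open import Data.Fin.Properties
  using (_≟_; toℕ-injective; injective⇒≤; any?; punchInᵢ≢i; combine-remQuot; remQuot-combine)
import Data.Fin.Properties as Finₚ
open import Data.Fin.Permutation using (Permutation)
open import Data.List using (List; []; _∷_; allFin; map; tabulate)
open import Data.List.Properties using (map-tabulate)
open import Data.List.Membership.Propositional using (_∈_; lose)
open import Data.List.Membership.Propositional.Properties using (∈-allFin; ∈-filter⁺; ∈-filter⁻)
open import Data.List.Relation.Unary.All as All using (_∷_)
open import Data.List.Relation.Unary.All.Properties using (all⁺; all⁻)
open import Data.List.Relation.Unary.AllPairs using (_∷_)
open import Data.List.Relation.Unary.Any using (here; there; satisfied)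
open import Data.List.Relation.Unary.Any.Properties using (any⁺; any⁻)
open import Data.List.Relation.Unary.Unique.Propositional using (Unique)
open import Data.List.Relation.Unary.Unique.Propositional.Properties using (allFin⁺; filter⁺)
open import Data.Product as Product using (Σ; _×_; _,_; ∃; ∃₂; ∃-syntax; proj₁; proj₂)
open import Data.Sum as Sum using (_⊎_; inj₁; inj₂)
open import Data.Unit using (tt)
open import Data.Empty using (⊥; ⊥-elim)
open import Function using (id; _∘_)
open import Function.Bundles using (Equivalence; _⇔_; mk⇔; mk↔ₛ′)
open import Function.Construct.Composition using (_⇔-∘_)
open import Function.Consequences.Propositional using (surjective⇒strictlySurjective)
open import Function.Definitions using (Injective; Bijective)
open import Relation.Nullary using (¬_; yes; no; ¬?)
open import Relation.Nullary.Decidable using (dec-true; decidable-stable)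
open import Relation.Binary.PropositionalEquality
open import Algebra.Properties.CommutativeMonoid.Sum +-0-commutativeMonoid
  using (sum-cong-≗; sum-replicate-zero; ∑-distrib-+; sum-permute)
  renaming (sum to ∑; sum-syntax to ∑-syntax)

open Equivalence using (to; from)

private
  variable
    m i j k q : ℕ

eqB-refl : ∀ {m} (u : Fin m) → T (eqB u u)
eqB-refl u = from T-≡ (dec-true (u ≟ u) refl)

eqB-sound : ∀ {m} {u v : Fin m} → T (eqB u v) → u ≡ v
eqB-sound {u = u} {v} t with u ≟ v
... | yes u≡v = u≡v

T-∧-not⇒T : ∀ {x y} → T x → ¬ T (x ∧ not y) → T y
T-∧-not⇒T {true} {true}  _ _   = tt
T-∧-not⇒T {true} {false} _ ¬tt = ⊥-elim (¬tt tt)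

¬T⇒≡false : ∀ {b} → ¬ T b → b ≡ false
¬T⇒≡false {false} _  = refl
¬T⇒≡false {true}  ¬t = ⊥-elim (¬t tt)

bit : Bool → ℕ
bit true  = 1
bit false = 0

bit≤1 : ∀ b → bit b ≤ 1
bit≤1 true  = s≤s z≤n
bit≤1 false = z≤n

module _ {m : ℕ} {G : Graph m} where

  private
    variable
      u v x : Fin m

  _++ʷ_ : Walk G u x i → Walk G x v j → Walk G u v (i + j)
  here     ++ʷ q = q
  step a p ++ʷ q = step a (p ++ʷ q)

  adj-sym : T (adj G u v) → T (adj G v u)
  adj-sym = subst T (adjSym G _ _)

  walk-snoc : Walk G u x i → T (adj G x v) → Walk G u v (suc i)
  walk-snoc {i = i} p a = subst (Walk _ _ _) (+-comm i 1) (p ++ʷ step a here)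

  walk-reverse : Walk G u v k → Walk G v u k
  walk-reverse here       = here
  walk-reverse (step a p) = walk-snoc (walk-reverse p) (adj-sym a)

  reach-complete : Walk G u v j → j ≤ k → T (reach (adj G) k u v)
  reach-complete {u = u}     {k = zero}  here _ = eqB-refl u
  reach-complete {u = u} {v} {k = suc k} here _ =
    from (T-∨ {reach (adj G) k u v}) (inj₁ (reach-complete {k = k} here z≤n))
  reach-complete {u = u} {v} {k = suc k} (step {x = x} a p) (s≤s j≤k) =
    from (T-∨ {reach (adj G) k u v})
      (inj₂ (any⁺ _ (lose (∈-allFin x) (from T-∧ (a , reach-complete p j≤k)))))

  reach-sound : ∀ k → T (reach (adj G) k u v) → ∃[ j ] j ≤ k × Walk G u v j
  reach-sound {u = u} {v} zero t with refl ← eqB-sound {u = u} {v} t = 0 , z≤n , here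
  reach-sound {u = u} {v} (suc k) t with to (T-∨ {reach (adj G) k u v}) t
  ... | inj₁ r with j , j≤k , p ← reach-sound k r = j , m≤n⇒m≤1+n j≤k , p
  ... | inj₂ r with x , ax ← satisfied (any⁻ _ (allFin m) r)
               with a , r′ ← to (T-∧ {adj G u x}) ax
               with j , j≤k , p ← reach-sound k r′ = suc j , s≤s j≤k , step a p

  walk-vertex : Walk G u v k → Fin (suc k) → Fin m
  walk-vertex {u = u} _          zero    = u
  walk-vertex         (step a p) (suc i) = walk-vertex p i

  walk-vertex-last : (p : Walk G u v k) → walk-vertex p (fromℕ k) ≡ v
  walk-vertex-last here       = refl
  walk-vertex-last (step a p) = walk-vertex-last p

  walk-vertex-adj : (p : Walk G u v k) (i : Fin k) →
                    T (adj G (walk-vertex p (inject₁ i)) (walk-vertex p (suc i)))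
  walk-vertex-adj (step a here)       zero    = a
  walk-vertex-adj (step a (step _ _)) zero    = a
  walk-vertex-adj (step a p)          (suc i) = walk-vertex-adj p i

  IsPath : Walk G u v k → Set
  IsPath p = Injective _≡_ _≡_ (walk-vertex p)

  path-length< : (p : Walk G u v k) → IsPath p → k < m
  path-length< p p-path = injective⇒≤ p-path

  path-tail : {a : T (adj G u x)} {p : Walk G x v k} → IsPath (step a p) → IsPath p
  path-tail path e = Finₚ.suc-injective (path e)

  walk-drop : (p : Walk G u v k) (i : Fin (suc k)) →
              ∃[ j ] Σ (Walk G (walk-vertex p i) v j) λ s → IsPath p → IsPath s
  walk-drop {k = k} p          zero    = k , p , id
  walk-drop         (step a p) (suc i) with j , s , keeps-path ← walk-drop p i = j , s , keeps-path ∘ path-tail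

  walk⇒path : Walk G u v k → ∃[ j ] Σ (Walk G u v j) IsPath
  walk⇒path here = 0 , here , λ { {zero} {zero} _ → refl }
  walk⇒path {u = u} (step a p) with j , q , q-path ← walk⇒path p | any? (λ i → walk-vertex q i ≟ u)
  ... | yes (i , refl) with j′ , s , keeps-path ← walk-drop q i = j′ , s , keeps-path q-path
  ... | no u∉q = suc j , step a q , path
    where
    path : IsPath (step a q)
    path {zero}  {zero}  _ = refl
    path {zero}  {suc y} e = ⊥-elim (u∉q (y , sym e))
    path {suc x} {zero}  e = ⊥-elim (u∉q (x , e))
    path {suc x} {suc y} e = cong suc (q-path e)

  walk⇒reach : Walk G u v k → T (reach (adj G) m u v)
  walk⇒reach p with j , q , q-path ← walk⇒path p = reach-complete q (<⇒≤ (path-length< q q-path))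

  reach⇒walk : T (reach (adj G) m u v) → ∃ (Walk G u v)
  reach⇒walk r with j , _ , p ← reach-sound m r = j , p

  walk-length< : Walk G u v k → ∃[ j ] j < m × Walk G u v j
  walk-length< p with j , q , q-path ← walk⇒path p = j , path-length< q q-path , q

_⊆ᴳ_ : Graph m → Graph m → Set
G ⊆ᴳ H = ∀ {a b} → T (adj G a b) → T (adj H a b)

OnlyEdgeMissing : Graph m → Graph m → Fin m → Fin m → Set
OnlyEdgeMissing G H c c' =
  ∀ {a b} → T (adj G a b) → ¬ T (adj H a b) → (a ≡ c × b ≡ c') ⊎ (a ≡ c' × b ≡ c)

module _ {m} {G H : Graph m} (G⊆H : G ⊆ᴳ H) where

  walk-map : ∀ {u v} → Walk G u v k → Walk H u v k
  walk-map here       = here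
  walk-map (step a p) = step (G⊆H a) (walk-map p)

  walk-map-vertex : ∀ {u v} (p : Walk G u v k) i → walk-vertex (walk-map p) i ≡ walk-vertex p i
  walk-map-vertex p          zero    = refl
  walk-map-vertex (step a p) (suc i) = walk-map-vertex p i

  walk-map-path : ∀ {u v} {p : Walk G u v k} → IsPath p → IsPath (walk-map p)
  walk-map-path {p = p} p-path {i} {j} e =
    p-path (trans (sym (walk-map-vertex p i)) (trans e (walk-map-vertex p j)))

path-closes-cycle : {G : Graph m} {a b : Fin m} (p : Walk G a b (suc (suc k))) →
                    IsPath p → T (adj G b a) → HasCycle G
path-closes-cycle {k = k} {G = G} p p-path ba =
  k , walk-vertex p , p-path , walk-vertex-adj p ,
  subst (λ x → T (adj G x _)) (sym (walk-vertex-last p)) ba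

withoutEdge : Graph m → Fin m → Fin m → Graph m
withoutEdge G c c' = record
  { adj    = removeEdge (adj G) c c'
  ; adjSym = λ a b → cong₂ _∧_ (adjSym G a b) (cong not (swap-pairs a b))
  ; adjIrr = λ a → cong (_∧ _) (adjIrr G a)
  }
  where
  swap-pairs : ∀ a b → (eqB a c ∧ eqB b c') ∨ (eqB a c' ∧ eqB b c)
                     ≡ (eqB b c ∧ eqB a c') ∨ (eqB b c' ∧ eqB a c)
  swap-pairs a b = trans (∨-comm (eqB a c ∧ eqB b c') _)
                         (cong₂ _∨_ (∧-comm (eqB a c') _) (∧-comm (eqB a c) _))

module _ {G : Graph m} {c c' : Fin m} where

  withoutEdge⊆ : withoutEdge G c c' ⊆ᴳ G
  withoutEdge⊆ {a} t = proj₁ (to (T-∧ {adj G a _}) t)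

  removed-edge : OnlyEdgeMissing G (withoutEdge G c c') c c'
  removed-edge {a} {b} ab ¬ab⁻ with to (T-∨ {eqB a c ∧ eqB b c'}) (T-∧-not⇒T ab ¬ab⁻)
  ... | inj₁ t = inj₁ (Product.map eqB-sound eqB-sound (to (T-∧ {eqB a c}) t))
  ... | inj₂ t = inj₂ (Product.map eqB-sound eqB-sound (to (T-∧ {eqB a c'}) t))

  withoutEdge-removes : ¬ T (adj (withoutEdge G c c') c c')
  withoutEdge-removes t with to (T-∧ {adj G c c'}) t
  ... | _ , ¬cc' = subst T (to T-not-≡ ¬cc')
                         (from (T-∨ {eqB c c ∧ eqB c' c'}) (inj₁ (from T-∧ (eqB-refl c , eqB-refl c'))))

  withoutNonEdge⊇ : ¬ T (adj G c c') → G ⊆ᴳ withoutEdge G c c'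
  withoutNonEdge⊇ ¬cc' {a} {b} ab with T? (adj (withoutEdge G c c') a b)
  ... | yes ab⁻ = ab⁻
  ... | no ¬ab⁻ with removed-edge ab ¬ab⁻
  ...   | inj₁ (refl , refl) = ⊥-elim (¬cc' ab)
  ...   | inj₂ (refl , refl) = ⊥-elim (¬cc' (adj-sym {G = G} ab))

module _ {G H : Graph m} {c c' : Fin m} (H⊆G : H ⊆ᴳ G) (only-cc' : OnlyEdgeMissing G H c c') where

  walk-decompose : ∀ {x u} → Walk G x u k →
                   Walk H x u k ⊎ ∃[ j ] j < k × (Walk H x c j ⊎ Walk H x c' j)
  walk-decompose here = inj₁ here
  walk-decompose {x = x} (step {x = y} a p) with T? (adj H x y)
  ... | no ¬a with only-cc' a ¬a
  ...   | inj₁ (refl , _) = inj₂ (0 , s≤s z≤n , inj₁ here)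
  ...   | inj₂ (refl , _) = inj₂ (0 , s≤s z≤n , inj₂ here)
  walk-decompose (step a p) | yes a⁻ with walk-decompose p
  ...   | inj₁ q                 = inj₁ (step a⁻ q)
  ...   | inj₂ (j , j<k , inj₁ q) = inj₂ (suc j , s≤s j<k , inj₁ (step a⁻ q))
  ...   | inj₂ (j , j<k , inj₂ q) = inj₂ (suc j , s≤s j<k , inj₂ (step a⁻ q))

minSearch-≤ : ∀ f fuel start {j} → start ≤ j → T (f j) → minSearch f fuel start ≤ j
minSearch-≤ f zero       start start≤j fj = start≤j
minSearch-≤ f (suc fuel) start start≤j fj with f start in eq
... | true  = start≤j
... | false = minSearch-≤ f fuel (suc start) (≤∧≢⇒< start≤j start≢j) fj
  where
  start≢j : start ≢ _
  start≢j refl = subst T eq fj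

minSearch-found : ∀ f fuel start →
                  T (f (minSearch f fuel start)) ⊎ minSearch f fuel start ≡ start + fuel
minSearch-found f zero       start = inj₂ (sym (+-identityʳ start))
minSearch-found f (suc fuel) start with f start in eq
... | true  = inj₁ (subst T (sym eq) tt)
... | false with minSearch-found f fuel (suc start)
...   | inj₁ found = inj₁ found
...   | inj₂ fuel-out = inj₂ (trans fuel-out (sym (+-suc start fuel)))

module _ (Tr : Tree m) where

  private
    G = graph Tr

  dist-≤ : ∀ {u v} → Walk G u v k → dist Tr u v ≤ k
  dist-≤ p = minSearch-≤ _ m 0 z≤n (reach-complete p ≤-refl)

  dist-realised : ∀ u v → ∃[ j ] j ≤ dist Tr u v × Walk G u v j
  dist-realised u v with minSearch-found (λ k → reach (adj G) k u v) m 0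
  ... | inj₁ found  = reach-sound _ found
  ... | inj₂ dist≡m with j , j<m , p ← walk-length< (proj₂ (connected Tr u v)) =
    j , subst (j ≤_) (sym dist≡m) (<⇒≤ j<m) , p

  module _ {H : Graph m} {c c' : Fin m}
           (H⊆G : H ⊆ᴳ G) (only-cc' : OnlyEdgeMissing G H c c') (cc' : T (adj G c c')) where

    dist-across : ∀ {x} → (∀ {k} → ¬ Walk H x c' k) → dist Tr x c' ≡ suc (dist Tr x c)
    dist-across {x} x↛c' = ≤-antisym via-c shortest
      where
      via-c : dist Tr x c' ≤ suc (dist Tr x c)
      via-c with j , j≤d , p ← dist-realised x c = ≤-trans (dist-≤ (walk-snoc p cc')) (s≤s j≤d)
      shortest : suc (dist Tr x c) ≤ dist Tr x c'
      shortest with k , k≤d , p ← dist-realised x c' | walk-decompose H⊆G only-cc' p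
      ... | inj₁ q                 = ⊥-elim (x↛c' q)
      ... | inj₂ (_ , _ , inj₂ q)   = ⊥-elim (x↛c' q)
      ... | inj₂ (j , j<k , inj₁ q) = ≤-trans (s≤s (dist-≤ (walk-map H⊆G q))) (≤-trans j<k k≤d)

sum-allFin : ∀ k (f : Fin k → ℕ) → sum (map f (allFin k)) ≡ ∑[ i < k ] f i
sum-allFin k f = trans (cong sum (map-tabulate id f)) (sum-tabulate k f)
  where
  sum-tabulate : ∀ k (f : Fin k → ℕ) → sum (tabulate f) ≡ ∑[ i < k ] f i
  sum-tabulate zero    f = refl
  sum-tabulate (suc k) f = cong (f zero +_) (sum-tabulate k (f ∘ suc))

∑-const : ∀ k c → ∑[ _ < k ] c ≡ k * c
∑-const zero    c = refl
∑-const (suc k) c = cong (c +_) (∑-const k c)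

∑-≤ : (d : Fin q → ℕ) {c : ℕ} → (∀ t → d t ≤ c) → ∑ d ≤ q * c
∑-≤ {zero}  d d≤c = z≤n
∑-≤ {suc q} d d≤c = +-mono-≤ (d≤c zero) (∑-≤ (d ∘ suc) (d≤c ∘ suc))

∑-↑ : ∀ a b (F : Fin (a + b) → ℕ) → ∑ F ≡ ∑[ i < a ] F (i ↑ˡ b) + ∑[ j < b ] F (a ↑ʳ j)
∑-↑ zero    b F = refl
∑-↑ (suc a) b F = trans (cong (F zero +_) (∑-↑ a b (F ∘ suc))) (sym (+-assoc (F zero) _ _))

∑-combine : ∀ m n (F : Fin (m * n) → ℕ) → ∑ F ≡ ∑[ x < m ] ∑[ y < n ] F (combine x y)
∑-combine zero    n F = refl
∑-combine (suc m) n F =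
  trans (∑-↑ n (m * n) F) (cong (∑[ y < n ] F (y ↑ˡ (m * n)) +_) (∑-combine m n (F ∘ (n ↑ʳ_))))

∑-bijection : ∀ {m n} (z : Fin k → Fin m × Fin n) → Bijective _≡_ _≡_ z →
              (h : Fin m × Fin n → ℕ) → ∑[ i < k ] h (z i) ≡ ∑[ x < m ] ∑[ y < n ] h (x , y)
∑-bijection {k} {m} {n} z (z-injective , z-surjective) h = begin
  ∑[ i < k ] h (z i)                       ≡⟨ sum-cong-≗ (λ i → cong h (sym (remQuot-index i))) ⟩
  ∑[ i < k ] F (index i)                   ≡⟨ sum-permute F π ⟨
  ∑[ j < m * n ] F j                       ≡⟨ ∑-combine m n F ⟩
  ∑[ x < m ] ∑[ y < n ] F (combine x y)    ≡⟨ sum-cong-≗ (λ x → sum-cong-≗ (cong h ∘ remQuot-combine x)) ⟩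
  ∑[ x < m ] ∑[ y < n ] h (x , y)          ∎
  where
  open ≡-Reasoning
  F : Fin (m * n) → ℕ
  F = h ∘ remQuot n
  index : Fin k → Fin (m * n)
  index i = combine (proj₁ (z i)) (proj₂ (z i))
  remQuot-index : ∀ i → remQuot n (index i) ≡ z i
  remQuot-index i = remQuot-combine (proj₁ (z i)) (proj₂ (z i))
  index⁻¹ : Fin (m * n) → Fin k
  index⁻¹ j = proj₁ (z-surjective (remQuot n j))
  z-index⁻¹ : ∀ j → z (index⁻¹ j) ≡ remQuot n j
  z-index⁻¹ j = proj₂ (z-surjective (remQuot n j)) refl
  π : Permutation k (m * n)
  π = mk↔ₛ′ index index⁻¹
        (λ j → trans (cong (λ p → combine (proj₁ p) (proj₂ p)) (z-index⁻¹ j)) (combine-remQuot {m} n j))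
        (λ i → z-injective (trans (z-index⁻¹ (index i)) (remQuot-index i)))

module EdgeCut (Tr : Tree m) {c c' : Fin m} (cc' : T (adj (graph Tr) c c')) where

  private
    G  = graph Tr
    G⁻ = withoutEdge G c c'
    G⁻⊆G = withoutEdge⊆ {G = G} {c} {c'}

  side : Fin m → Bool
  side x = reach (adj G⁻) m x c

  separated : ¬ Walk G⁻ c c' k
  separated p with walk⇒path p
  ... | _ , here , _ = subst T (adjIrr G c) cc'
  ... | _ , step cc'⁻ here , _ = withoutEdge-removes {G = G} cc'⁻
  ... | _ , q@(step _ (step _ _)) , q-path =
    acyclic Tr (path-closes-cycle {G = G} (walk-map G⁻⊆G q) (walk-map-path G⁻⊆G q-path) (adj-sym {G = G} cc'))

  not-both-ends : ∀ {x} → Walk G⁻ x c i → Walk G⁻ x c' j → ⊥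
  not-both-ends p q = separated (walk-reverse p ++ʷ q)

  end : Fin m → Fin m
  end x = if side x then c else c'

  reaches-end : ∀ x → ∃ (Walk G⁻ x (end x))
  reaches-end x with side x in sx
  ... | true = reach⇒walk (from T-≡ sx)
  ... | false with walk-decompose G⁻⊆G (removed-edge {G = G}) (proj₂ (connected Tr x c))
  ...   | inj₁ p                = ⊥-elim (subst T sx (walk⇒reach p))
  ...   | inj₂ (_ , _ , inj₁ p) = ⊥-elim (subst T sx (walk⇒reach p))
  ...   | inj₂ (_ , _ , inj₂ p) = _ , p

  reach-withoutEdge : ∀ u v → reach (adj G⁻) m u v ≡ not (side u xor side v)
  reach-withoutEdge u v with side u | side v | reaches-end u | reaches-end v
  ... | true  | true  | _ , p | _ , q = to T-≡ (walk⇒reach (p ++ʷ walk-reverse q))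
  ... | false | false | _ , p | _ , q = to T-≡ (walk⇒reach (p ++ʷ walk-reverse q))
  ... | true  | false | _ , p | _ , q =
    ¬T⇒≡false λ r → not-both-ends p (proj₂ (reach⇒walk r) ++ʷ q)
  ... | false | true  | _ , p | _ , q =
    ¬T⇒≡false λ r → not-both-ends (proj₂ (reach⇒walk r) ++ʷ q) p

  side-c : side c ≡ true
  side-c = to T-≡ (walk⇒reach {G = G⁻} here)

  side-c' : side c' ≡ false
  side-c' = ¬T⇒≡false λ r → not-both-ends (proj₂ (reach⇒walk r)) here

  δT-side : weightCenters Tr ≡ c ∷ c' ∷ [] → ∀ u v → δT Tr u v ≡ bit (side u xor side v)
  δT-side centers u v rewrite centers | reach-withoutEdge u v with side u xor side v
  ... | true  = refl
  ... | false = refl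

  dist-side : ∀ x → dist Tr x c' + bit (not (side x)) ≡ dist Tr x c + bit (side x)
  dist-side x with side x | reaches-end x
  ... | true  | _ , p = trans (+-identityʳ _) (trans c'-beyond-c (+-comm 1 _))
    where
    c'-beyond-c : dist Tr x c' ≡ suc (dist Tr x c)
    c'-beyond-c = dist-across Tr G⁻⊆G (removed-edge {G = G}) cc' (not-both-ends p)
  ... | false | _ , q = trans (+-comm _ 1) (sym (trans (+-identityʳ _) c-beyond-c'))
    where
    c-beyond-c' : dist Tr x c ≡ suc (dist Tr x c')
    c-beyond-c' = dist-across Tr G⁻⊆G (λ ab ¬ab⁻ → Sum.swap (removed-edge {G = G} ab ¬ab⁻))
                    (adj-sym {G = G} cc') (λ p → not-both-ends p q)

  balanced : weight Tr c ≡ weight Tr c' → ∑[ x < m ] bit (side x) ≡ ∑[ x < m ] bit (not (side x))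
  balanced c≈c' = sym (+-cancelˡ-≡ (weight Tr c) _ _ (begin
    weight Tr c + ∑[ x < m ] outside x           ≡⟨ cong (_+ ∑ outside) c≈c' ⟩
    weight Tr c' + ∑[ x < m ] outside x          ≡⟨ cong (_+ ∑ outside) (sum-allFin m (λ x → dist Tr x c')) ⟩
    ∑[ x < m ] dist Tr x c' + ∑[ x < m ] outside x ≡⟨ ∑-distrib-+ (λ x → dist Tr x c') outside ⟨
    ∑[ x < m ] (dist Tr x c' + outside x)        ≡⟨ sum-cong-≗ dist-side ⟩
    ∑[ x < m ] (dist Tr x c + inside x)          ≡⟨ ∑-distrib-+ (λ x → dist Tr x c) inside ⟩
    ∑[ x < m ] dist Tr x c + ∑[ x < m ] inside x   ≡⟨ cong (_+ ∑ inside) (sum-allFin m (λ x → dist Tr x c)) ⟨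
    weight Tr c + ∑[ x < m ] inside x            ∎))
    where
    open ≡-Reasoning
    inside outside : Fin m → ℕ
    inside  x = bit (side x)
    outside x = bit (not (side x))

isWeightCenterB⇔ : (Tr : Tree m) (v : Fin m) → T (isWeightCenterB Tr v) ⇔ IsWeightCenter Tr v
isWeightCenterB⇔ {m} Tr v = mk⇔
  (λ t u → ≤ᵇ⇒≤ _ _ (All.lookup (all⁺ _ (allFin m) t) (∈-allFin u)))
  (λ center → all⁻ _ {allFin m} (All.tabulate λ {u} _ → ≤⇒≤ᵇ (center u)))

∈-weightCenters⇔ : (Tr : Tree m) {v : Fin m} → v ∈ weightCenters Tr ⇔ IsWeightCenter Tr v
∈-weightCenters⇔ {m} Tr {v} = mk⇔
  (λ v∈ → to (isWeightCenterB⇔ Tr v) (proj₂ (∈-filter⁻ P? {xs = allFin m} v∈)))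
  (λ center → ∈-filter⁺ P? (∈-allFin v) (from (isWeightCenterB⇔ Tr v) center))
  where
  P? = λ v → T? (isWeightCenterB Tr v)

unique-pair : ∀ {A : Set} {w w' : A} (xs : List A) → Unique xs → w ≢ w' →
              (∀ {v} → v ∈ xs → v ≡ w ⊎ v ≡ w') → w ∈ xs → w' ∈ xs →
              ∃₂ λ a b → xs ≡ a ∷ b ∷ []
unique-pair (a ∷ [])         _ w≢w' _ (here refl) (here refl) = ⊥-elim (w≢w' refl)
unique-pair (a ∷ b ∷ [])     _ _    _ _           _           = a , b , refl
unique-pair (a ∷ b ∷ c ∷ xs) ((a≢b ∷ a≢c ∷ _) ∷ (b≢c ∷ _) ∷ _) _ in-pair _ _
  with in-pair (here refl) | in-pair (there (here refl)) | in-pair (there (there (here refl)))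
... | inj₁ refl | inj₁ refl | _         = ⊥-elim (a≢b refl)
... | inj₂ refl | inj₂ refl | _         = ⊥-elim (a≢b refl)
... | inj₁ refl | inj₂ refl | inj₁ refl = ⊥-elim (a≢c refl)
... | inj₁ refl | inj₂ refl | inj₂ refl = ⊥-elim (b≢c refl)
... | inj₂ refl | inj₁ refl | inj₁ refl = ⊥-elim (b≢c refl)
... | inj₂ refl | inj₁ refl | inj₂ refl = ⊥-elim (a≢c refl)

weightCenters-unique : (Tr : Tree m) → Unique (weightCenters Tr)
weightCenters-unique {m} Tr = filter⁺ (λ v → T? (isWeightCenterB Tr v)) (allFin⁺ m)

weightCenters-pair : (Tr : Tree m) → TwoWeightCenters Tr →
                     ∃₂ λ c c' → weightCenters Tr ≡ c ∷ c' ∷ [] × weight Tr c ≡ weight Tr c'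
weightCenters-pair Tr (w , w' , w≢w' , w-center , w'-center , only-w-w')
  with unique-pair (weightCenters Tr) (weightCenters-unique Tr) w≢w'
         (λ v∈ → only-w-w' _ (to (∈-weightCenters⇔ Tr) v∈))
         (from (∈-weightCenters⇔ Tr) w-center) (from (∈-weightCenters⇔ Tr) w'-center)
... | c , c' , centers = c , c' , centers , ≤-antisym (center (here refl) c') (center (there (here refl)) c)
  where
  center : ∀ {v} → v ∈ c ∷ c' ∷ [] → IsWeightCenter Tr v
  center v∈ = to (∈-weightCenters⇔ Tr) (subst (_ ∈_) (sym centers) v∈)

two≤order : (Tr : Tree m) → TwoWeightCenters Tr → 2 ≤ m
two≤order {suc (suc _)} _ _                          = s≤s (s≤s z≤n)
two≤order {suc zero}    _ (zero , zero , w≢w' , _) = ⊥-elim (w≢w' refl)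

δT-nonadjacent : (Tr : Tree m) {c c' : Fin m} → weightCenters Tr ≡ c ∷ c' ∷ [] →
                 ¬ T (adj (graph Tr) c c') → ∀ u v → δT Tr u v ≡ 0
δT-nonadjacent Tr {c} {c'} centers ¬cc' u v
  rewrite centers
        | to T-≡ (walk⇒reach {G = withoutEdge (graph Tr) c c'}
                   (walk-map (withoutNonEdge⊇ {G = graph Tr} ¬cc') (proj₂ (connected Tr u v))))
  = refl

record BalancedSide (Tr : Tree m) : Set where
  field
    side     : Fin m → Bool
    δT-side  : ∀ u v → δT Tr u v ≡ bit (side u xor side v)
    balanced : ∑[ x < m ] bit (side x) ≡ ∑[ x < m ] bit (not (side x))
    inside   : ∃ λ x → side x ≡ true
    outside  : ∃ λ x → side x ≡ false

-- The two weight centers are in fact adjacent, but the argument never needs this: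
-- for a non-adjacent pair δT vanishes identically, which is the unsplit case.
data WeightCut (Tr : Tree m) : Set where
  unsplit : (∀ u v → δT Tr u v ≡ 0) → WeightCut Tr
  split   : BalancedSide Tr → WeightCut Tr

weightCut : (Tr : Tree m) → TwoWeightCenters Tr → WeightCut Tr
weightCut Tr two with weightCenters-pair Tr two
... | c , c' , centers , c≈c' with T? (adj (graph Tr) c c')
...   | no ¬cc' = unsplit (δT-nonadjacent Tr centers ¬cc')
...   | yes cc' = split record
  { side = side ; δT-side = δT-side centers ; balanced = balanced c≈c'
  ; inside = c , side-c ; outside = c' , side-c' }
  where open EdgeCut Tr cc'

δT≤1 : {Tr : Tree m} → WeightCut Tr → ∀ u v → δT Tr u v ≤ 1
δT≤1 (unsplit δT≡0) u v = subst (_≤ 1) (sym (δT≡0 u v)) z≤n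
δT≤1 (split B)      u v = subst (_≤ 1) (sym (BalancedSide.δT-side B u v)) (bit≤1 _)

DipsOnceAt : (Fin q → ℕ) → ℕ → Set
DipsOnceAt {q} d c = (∀ (t : Fin q) → toℕ t ≡ c → d t ≡ 1) × (∀ (t : Fin q) → toℕ t ≢ c → d t ≡ 2)

∑-<-with-dip : (d : Fin q → ℕ) → (∀ t → d t ≤ 2) → ∀ t₀ → d t₀ ≤ 1 → ∑ d < q * 2
∑-<-with-dip d d≤2 zero     d₀≤1 = +-mono-≤ (s≤s d₀≤1) (∑-≤ (d ∘ suc) (d≤2 ∘ suc))
∑-<-with-dip {suc q} d d≤2 (suc t₀) dip = subst (_≤ suc q * 2) (+-suc (d zero) (∑ (d ∘ suc)))
  (+-mono-≤ (d≤2 zero) (∑-<-with-dip (d ∘ suc) (d≤2 ∘ suc) t₀ dip))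

∑≡⇒all-2 : (d : Fin q → ℕ) → (∀ t → d t ≤ 2) → ∑ d ≡ q * 2 → ∀ t → d t ≡ 2
∑≡⇒all-2 d d≤2 ∑≡ t with d t ≤? 1
... | yes dip = ⊥-elim (<⇒≢ (∑-<-with-dip d d≤2 t dip) ∑≡)
... | no ¬dip = ≤-antisym (d≤2 t) (≰⇒> ¬dip)

∑≡⇒single-dip : (d : Fin q → ℕ) → (∀ t → d t ≤ 2) → suc (∑ d) ≡ q * 2 →
                ∃ λ t* → d t* ≡ 1 × (∀ t → t ≢ t* → d t ≡ 2)
∑≡⇒single-dip {suc q} d d≤2 ∑≡ with d zero in d₀ | d≤2 zero
... | 0 | _ = ⊥-elim (<⇒≱ (≤-reflexive (sym (suc-injective ∑≡))) (∑-≤ (d ∘ suc) (d≤2 ∘ suc)))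
... | 1 | _ = zero , d₀ , λ { zero 0≢0 → ⊥-elim (0≢0 refl) ; (suc t) _ → rest-2 t }
  where rest-2 = ∑≡⇒all-2 (d ∘ suc) (d≤2 ∘ suc) (suc-injective (suc-injective ∑≡))
... | 2 | _
  with t* , dip , rest-2 ← ∑≡⇒single-dip (d ∘ suc) (d≤2 ∘ suc) (suc-injective (suc-injective ∑≡)) =
  suc t* , dip , λ { zero _ → d₀ ; (suc t) t≢t* → rest-2 t (t≢t* ∘ cong suc) }
... | suc (suc (suc _)) | s≤s (s≤s ())

DipsOnceAt⇒∑≡ : (d : Fin q → ℕ) {c : ℕ} → c < q → DipsOnceAt d c → suc (∑ d) ≡ q * 2
DipsOnceAt⇒∑≡ {suc q} d {zero} _ (at-c , elsewhere)
  rewrite at-c zero refl = cong (2 +_) (trans (sum-cong-≗ (λ t → elsewhere (suc t) λ ())) (∑-const q 2))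
DipsOnceAt⇒∑≡ {suc q} d {suc c} (s≤s c<q) (at-c , elsewhere)
  rewrite elsewhere zero (λ ()) =
  cong (2 +_) (DipsOnceAt⇒∑≡ (d ∘ suc) c<q
    ((λ t → at-c (suc t) ∘ cong suc) , (λ t → elsewhere (suc t) ∘ (_∘ suc-injective))))

record SingleDipProfile (d : Fin q → ℕ) (c : ℕ) : Set where
  field
    at-most-2    : ∀ t → d t ≤ 2
    dip          : ∃ λ t → d t ≤ 1
    dip-position : ∀ t* → d t* ≡ 1 → (∀ t → t ≢ t* → d t ≡ 2) → toℕ t* ≡ c

-- Vacuous dip-position: with q ≥ 2 some value besides the dip would have to be 2.
≤1-profile : 2 ≤ q → (d : Fin q → ℕ) → (∀ t → d t ≤ 1) → {c : ℕ} → SingleDipProfile d c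
≤1-profile {suc zero}    (s≤s ()) _ _
≤1-profile {suc (suc q)} _ d d≤1 = record
  { at-most-2    = λ t → m≤n⇒m≤1+n (d≤1 t)
  ; dip          = zero , d≤1 zero
  ; dip-position = λ t* _ rest-2 → ⊥-elim (2≰1 (subst (_≤ 1) (rest-2 _ (punchInᵢ≢i t* zero)) (d≤1 _)))
  }
  where
  2≰1 : ¬ 2 ≤ 1
  2≰1 (s≤s ())

2*suc∸3≡pred : ∀ q → 2 * suc q ∸ 3 ≡ pred (q * 2)
2*suc∸3≡pred q = cong (_∸ 3) (*-comm 2 (suc q))

single-dip-criterion : (d : Fin q → ℕ) {c : ℕ} → c < q → SingleDipProfile d c →
  (∑ d ≤ 2 * suc q ∸ 3) × (∑ d ≡ 2 * suc q ∸ 3 ⇔ DipsOnceAt d c)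
single-dip-criterion {suc q} d {c} c<q profile =
  subst (λ bound → (∑ d ≤ bound) × (∑ d ≡ bound ⇔ DipsOnceAt d c)) (sym (2*suc∸3≡pred (suc q)))
    ( <⇒≤pred (∑-<-with-dip d at-most-2 (proj₁ dip) (proj₂ dip))
    , mk⇔ (λ ∑≡ → shape (∑≡⇒single-dip d at-most-2 (cong suc ∑≡)))
          (λ dips → cong pred (DipsOnceAt⇒∑≡ d c<q dips)) )
  where
  open SingleDipProfile profile
  shape : (∃ λ t* → d t* ≡ 1 × (∀ t → t ≢ t* → d t ≡ 2)) → DipsOnceAt d c
  shape (t* , dip₁ , rest-2) =
    (λ t t≡c → subst (λ t → d t ≡ 1) (toℕ-injective (trans t*≡c (sym t≡c))) dip₁) ,
    (λ t t≢c → rest-2 t (λ t≡t* → t≢c (trans (cong toℕ t≡t*) t*≡c)))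
    where
    t*≡c = dip-position t* dip₁ rest-2

xor-interchange : ∀ a a' b b' → (a xor a') xor (b xor b') ≡ (a xor b) xor (a' xor b')
xor-interchange false false b b' = refl
xor-interchange false true  b b' = not-distribʳ-xor b b'
xor-interchange true  false b b' = not-distribˡ-xor b b'
xor-interchange true  true  b b' = sym (xor-annihilates-not b b')

bit+bit≡1⇔ : ∀ u v → bit u + bit v ≡ 1 ⇔ T (u xor v)
bit+bit≡1⇔ false false = mk⇔ (λ ()) (λ ())
bit+bit≡1⇔ false true  = mk⇔ _ (λ _ → refl)
bit+bit≡1⇔ true  false = mk⇔ _ (λ _ → refl)
bit+bit≡1⇔ true  true  = mk⇔ (λ ()) (λ ())

T-xor⇔≢ : ∀ a b → T (a xor b) ⇔ a ≢ b
T-xor⇔≢ false false = mk⇔ (λ ()) (λ f → f refl)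
T-xor⇔≢ false true  = mk⇔ (λ _ ()) _
T-xor⇔≢ true  false = mk⇔ (λ _ ()) _
T-xor⇔≢ true  true  = mk⇔ (λ ()) (λ f → f refl)

one-flip⇔colour-change : ∀ a a' b b' → bit (a xor a') + bit (b xor b') ≡ 1 ⇔ (a xor b) ≢ (a' xor b')
one-flip⇔colour-change a a' b b' =
  T-xor⇔≢ (a xor b) (a' xor b') ⇔-∘
    (mk⇔ (subst T interchange) (subst T (sym interchange)) ⇔-∘ bit+bit≡1⇔ (a xor a') (b xor b'))
  where
  interchange = xor-interchange a a' b b'

xor-injectiveʳ : ∀ a {b c} → a xor b ≡ a xor c → b ≡ c
xor-injectiveʳ false = id
xor-injectiveʳ true  = not-injective

no-change⇒constant : (g : Fin (suc q) → Bool) → (∀ t → g (inject₁ t) ≡ g (suc t)) →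
                     ∀ i → g i ≡ g zero
no-change⇒constant         g same zero    = refl
no-change⇒constant {suc q} g same (suc i) =
  trans (sym (same i)) (no-change⇒constant (g ∘ inject₁) (same ∘ inject₁) i)

change-exists : (g : Fin (suc q) → Bool) {i j : Fin (suc q)} → g i ≢ g j →
                ∃ λ t → g (inject₁ t) ≢ g (suc t)
change-exists {q} g {i} {j} gi≢gj with any? (λ t → ¬? (g (inject₁ t) Bool.≟ g (suc t)))
... | yes change = change
... | no ¬change = ⊥-elim (gi≢gj (trans (constant i) (sym (constant j))))
  where
  constant = no-change⇒constant g λ t → decidable-stable (g (inject₁ t) Bool.≟ g (suc t)) (¬change ∘ (t ,_))

count-before-change : (g : Fin (suc q) → Bool) (t* : Fin q) →
  (∀ t → t ≢ t* → g (inject₁ t) ≡ g (suc t)) → g (inject₁ t*) ≢ g (suc t*) →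
  ∑[ i < suc q ] bit (not (g zero) xor g i) ≡ suc (toℕ t*)
count-before-change {suc q} g zero same change rewrite xor-inverseˡ (g zero) =
  cong suc (trans (sum-cong-≗ after) (sum-replicate-zero (suc q)))
  where
  after : ∀ i → bit (not (g zero) xor g (suc i)) ≡ 0
  after i = cong bit (trans (cong (not (g zero) xor_) (trans tail-constant flipped)) (xor-same (not (g zero))))
    where
    tail-constant = no-change⇒constant (g ∘ suc) (λ t → same (suc t) λ ()) i
    flipped = ¬-not (change ∘ sym)
count-before-change {suc q} g (suc t*) same change rewrite xor-inverseˡ (g zero) | same zero (λ ()) =
  cong suc (count-before-change (g ∘ suc) t* (λ t t≢t* → same (suc t) (t≢t* ∘ Finₚ.suc-injective)) change)

module _ {m n : ℕ} (T₁ : Tree m) (T₂ : Tree n) {q : ℕ} (z : Fin (suc q) → Fin m × Fin n) where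

  consecutive : Fin q → ℕ
  consecutive t = δ T₁ T₂ (z (inject₁ t)) (z (Fin.suc t))

  module SplitOrdering (B₁ : BalancedSide T₁) (B₂ : BalancedSide T₂)
                       (z-bijective : Bijective _≡_ _≡_ z) (p≡mn : suc q ≡ m * n) where

    open BalancedSide B₁ renaming (side to s₁; δT-side to δT₁-side)
    open BalancedSide B₂ renaming (side to s₂; δT-side to δT₂-side; balanced to balanced₂)

    colour : Fin (suc q) → Bool
    colour i = s₁ (proj₁ (z i)) xor s₂ (proj₂ (z i))

    colour-at : ∀ {i x y} → z i ≡ (x , y) → colour i ≡ s₁ x xor s₂ y
    colour-at = cong λ (x , y) → s₁ x xor s₂ y

    side₁ side₁' side₂ side₂' : Fin q → Bool
    side₁  t = s₁ (proj₁ (z (inject₁ t)))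
    side₁' t = s₁ (proj₁ (z (Fin.suc t)))
    side₂  t = s₂ (proj₂ (z (inject₁ t)))
    side₂' t = s₂ (proj₂ (z (Fin.suc t)))

    consecutive≡flips : ∀ t → consecutive t ≡ bit (side₁ t xor side₁' t) + bit (side₂ t xor side₂' t)
    consecutive≡flips t = cong₂ _+_ (δT₁-side _ _) (δT₂-side _ _)

    consecutive≡1⇔colour-change : ∀ t → consecutive t ≡ 1 ⇔ colour (inject₁ t) ≢ colour (Fin.suc t)
    consecutive≡1⇔colour-change t =
      one-flip⇔colour-change (side₁ t) (side₁' t) (side₂ t) (side₂' t)
        ⇔-∘ mk⇔ (trans (sym (consecutive≡flips t))) (trans (consecutive≡flips t))

    consecutive≤2 : ∀ t → consecutive t ≤ 2
    consecutive≤2 t = subst (_≤ 2) (sym (consecutive≡flips t))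
                        (+-mono-≤ (bit≤1 (side₁ t xor side₁' t)) (bit≤1 (side₂ t xor side₂' t)))

    half : ℕ
    half = ∑[ y < n ] bit (s₂ y)

    side-count : ∀ k → ∑[ y < n ] bit (k xor s₂ y) ≡ half
    side-count false = refl
    side-count true  = sym balanced₂

    n≡half+half : n ≡ half + half
    n≡half+half = begin
      n                                               ≡⟨ *-identityʳ n ⟨
      n * 1                                           ≡⟨ ∑-const n 1 ⟨
      ∑[ y < n ] 1                                    ≡⟨ sum-cong-≗ (λ y → bit+bit-not (s₂ y)) ⟨
      ∑[ y < n ] (bit (s₂ y) + bit (not (s₂ y)))      ≡⟨ ∑-distrib-+ (bit ∘ s₂) (bit ∘ not ∘ s₂) ⟩
      half + ∑[ y < n ] bit (not (s₂ y))              ≡⟨ cong (half +_) balanced₂ ⟨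
      half + half                                     ∎
      where
      open ≡-Reasoning
      bit+bit-not : ∀ b → bit b + bit (not b) ≡ 1
      bit+bit-not true  = refl
      bit+bit-not false = refl

    colour-count : ∀ k → ∑[ i < suc q ] bit (k xor colour i) ≡ suc q / 2
    colour-count k = begin
      ∑[ i < suc q ] bit (k xor colour i)
        ≡⟨ ∑-bijection z z-bijective (λ (x , y) → bit (k xor (s₁ x xor s₂ y))) ⟩
      ∑[ x < m ] ∑[ y < n ] bit (k xor (s₁ x xor s₂ y))
        ≡⟨ sum-cong-≗ (λ x → sum-cong-≗ (λ y → cong bit (xor-assoc k (s₁ x) (s₂ y)))) ⟨
      ∑[ x < m ] ∑[ y < n ] bit ((k xor s₁ x) xor s₂ y)    ≡⟨ sum-cong-≗ (side-count ∘ (k xor_) ∘ s₁) ⟩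
      ∑[ x < m ] half                                      ≡⟨ ∑-const m half ⟩
      m * half                                             ≡⟨ m*n/n≡m (m * half) 2 ⟨
      m * half * 2 / 2                                     ≡⟨ cong (_/ 2) m*half*2≡p ⟩
      suc q / 2                                            ∎
      where
      open ≡-Reasoning
      m*half*2≡p : m * half * 2 ≡ suc q
      m*half*2≡p = begin
        m * half * 2         ≡⟨ *-assoc m half 2 ⟩
        m * (half * 2)       ≡⟨ cong (m *_) (trans (*-comm half 2) (cong (half +_) (+-identityʳ half))) ⟩
        m * (half + half)    ≡⟨ cong (m *_) n≡half+half ⟨
        m * n                ≡⟨ p≡mn ⟨
        suc q                ∎

    preimage : ∀ p → ∃ λ i → z i ≡ p
    preimage = surjective⇒strictlySurjective (proj₂ z-bijective)

    colour-changes : ∃ λ t → colour (inject₁ t) ≢ colour (Fin.suc t)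
    colour-changes
      with x , _ ← BalancedSide.inside B₁
      with y₁ , y₁-in ← BalancedSide.inside B₂ | y₀ , y₀-out ← BalancedSide.outside B₂
      with i₁ , z-i₁ ← preimage (x , y₁) | i₀ , z-i₀ ← preimage (x , y₀) =
      change-exists colour λ same-colour →
        true≢false (trans (sym y₁-in) (trans (xor-injectiveʳ (s₁ x)
          (trans (sym (colour-at z-i₁)) (trans same-colour (colour-at z-i₀)))) y₀-out))
      where
      true≢false : true ≢ false
      true≢false ()

    steady-off-dip : ∀ t* → (∀ t → t ≢ t* → consecutive t ≡ 2) →
                     ∀ t → t ≢ t* → colour (inject₁ t) ≡ colour (Fin.suc t)
    steady-off-dip t* rest-2 t t≢t* = decidable-stable (_ Bool.≟ _) λ change →
      2≢1 (trans (sym (rest-2 t t≢t*)) (from (consecutive≡1⇔colour-change t) change))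
      where
      2≢1 : 2 ≢ 1
      2≢1 ()

    dip-at-half : ∀ t* → consecutive t* ≡ 1 → (∀ t → t ≢ t* → consecutive t ≡ 2) →
                  toℕ t* ≡ pred (suc q / 2)
    dip-at-half t* one rest-2 = cong pred (begin
      suc (toℕ t*)                                        ≡⟨ count-before-change colour t* (steady-off-dip t* rest-2)
                                                               (to (consecutive≡1⇔colour-change t*) one) ⟨
      ∑[ i < suc q ] bit (not (colour Fin.zero) xor colour i) ≡⟨ colour-count (not (colour Fin.zero)) ⟩
      suc q / 2                                           ∎)
      where open ≡-Reasoning

    split-profile : SingleDipProfile consecutive (pred (suc q / 2))
    split-profile = record
      { at-most-2    = consecutive≤2
      ; dip          = t , ≤-reflexive (from (consecutive≡1⇔colour-change t) change)
      ; dip-position = dip-at-half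
      }
      where
      t      = proj₁ colour-changes
      change = proj₂ colour-changes

  ordering-profile : Bijective _≡_ _≡_ z → suc q ≡ m * n → 2 ≤ q →
                     WeightCut T₁ → WeightCut T₂ → SingleDipProfile consecutive (pred (suc q / 2))
  ordering-profile _ _ 2≤q (unsplit δ₁≡0) cut₂ =
    ≤1-profile 2≤q consecutive λ t → subst (_≤ 1) (cong (_+ _) (sym (δ₁≡0 _ _))) (δT≤1 cut₂ _ _)
  ordering-profile _ _ 2≤q cut₁ (unsplit δ₂≡0) =
    ≤1-profile 2≤q consecutive λ t →
      subst (_≤ 1) (trans (sym (+-identityʳ _)) (cong (_ +_) (sym (δ₂≡0 _ _)))) (δT≤1 cut₁ _ _)
  ordering-profile z-bijective p≡mn _ (split B₁) (split B₂) = SplitOrdering.split-profile B₁ B₂ z-bijective p≡mn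

pred-half< : ∀ q → 1 ≤ q → pred (suc q / 2) < q
pred-half< (suc q) _ = s≤s (pred-mono-≤ (<⇒≤pred (m/n<m (suc (suc q)) 2 (s≤s (s≤s z≤n)))))

lemma2p6 : ∀ {m n : ℕ} (T₁ : Tree m) (T₂ : Tree n) →
    TwoWeightCenters T₁ → TwoWeightCenters T₂ →
    ∀ (q : ℕ) → suc q ≡ m * n →
    ∀ (z : Fin (suc q) → Fin m × Fin n) → Bijective _≡_ _≡_ z →
    (consecutiveSum T₁ T₂ z ≤ 2 * (m * n) ∸ 3) ×
    (consecutiveSum T₁ T₂ z ≡ 2 * (m * n) ∸ 3 ⇔
      ((∀ (t : Fin q) → toℕ t ≡ (m * n) / 2 ∸ 1 →
          δ T₁ T₂ (z (inject₁ t)) (z (Fin.suc t)) ≡ 1) ×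
       (∀ (t : Fin q) → toℕ t ≢ (m * n) / 2 ∸ 1 →
          δ T₁ T₂ (z (inject₁ t)) (z (Fin.suc t)) ≡ 2)))
lemma2p6 T₁ T₂ two₁ two₂ q p≡mn z z-bijective
  rewrite sum-allFin q (consecutive T₁ T₂ z) | sym p≡mn =
  single-dip-criterion (consecutive T₁ T₂ z) (pred-half< q (≤-trans (s≤s z≤n) 2≤q))
    (ordering-profile T₁ T₂ z z-bijective p≡mn 2≤q (weightCut T₁ two₁) (weightCut T₂ two₂))
  where
  2≤q : 2 ≤ q
  2≤q = ≤-trans (n≤1+n 2) (s≤s⁻¹ (subst (4 ≤_) (sym p≡mn) 4≤mn))
    where 4≤mn = *-mono-≤ (two≤order T₁ two₁) (two≤order T₂ two₂)
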